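{- Let $T$ be a planar binary rooted tree with $n\ge2$ leaves and $0\le d\le n-2$. The number $E(T,\ell,d)=|\{\sigma\in S(T,\ell):d_\sigma=d\}|$ does not depend on the choice of the admissible labeling $\ell$ of $T$ by $\{1,\ldots,n\}$.
   Context: Planar binary rooted trees have a univalent root. A labeling $\ell$ of the leaves by $\{1,\ldots,n\}$ is admissible if it is injective and for every inner vertex $v$, among the leaves descending from $v$ the leftmost has the minimal and the rightmost the maximal label. For an inner vertex $v$, $\varepsilon(v)=1$ if $v$ is adjacent to the root edge or a right child, $\varepsilon(v)=-1$ if $v$ is a left child; a leaf is removable if it is the left child of a vertex $v$ with $\varepsilon(v)=1$ or the right child of a vertex $v$ with $\varepsilon(v)=-1$. Removing a leaf deletes it and its parent, attaching its sibling subtree in the parent's place. $S(T,\ell)\subset S_{n-1}$ is the set of $\sigma$ such that for each $1\le i\le n-1$ the leaf labeled $\sigma(i)$ is removable in the tree obtained from $T$ by removing the leaves labeled $\sigma(1),\ldots,\sigma(i-1)$. The descent number of $\sigma\in S_{n-1}$ is $d_\sigma=|\{i:\sigma(i)>\sigma(i+1)\}|$. -}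

module Defs where

open import Data.Nat using (ℕ; zero; suc; _+_; _≤_; _<ᵇ_; _≡ᵇ_; _∸_)
open import Data.Nat.Properties using (_≤?_; _≟_)
open import Data.Bool using (Bool; true; false; if_then_else_; T)
open import Data.Maybe using (Maybe; just; nothing; _<∣>_)
import Data.Maybe as Maybe
open import Data.List using (List; []; _∷_; _++_; concatMap; map; filter; length; upTo)
open import Data.List.Relation.Unary.All using (All)
open import Data.List.Relation.Unary.Unique.Propositional using (Unique)
open import Data.List.Relation.Unary.Unique.DecPropositional _≟_ using (unique?)
open import Data.Product using (_×_)
open import Data.Unit using (⊤)
open import Relation.Binary.PropositionalEquality using (_≡_)
open import Relation.Nullary.Decidable using (_×-dec_)
open import Data.Bool.Properties using (T?)

-- Planar binary rooted trees (the univalent root edge is implicit: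
-- a tree is either a single leaf or an inner vertex with an ordered
-- pair (left, right) of subtrees).

data Tree : Set where
  leaf : Tree
  node : Tree → Tree → Tree

leaves : Tree → ℕ
leaves leaf = 1
leaves (node l r) = leaves l + leaves r

-- Leaf-labelled planar binary trees: a labelling ℓ of the leaves of T
-- is recorded as a tree of the same shape carrying a label at each leaf.

data LTree : Set where
  lleaf : ℕ → LTree
  lnode : LTree → LTree → LTree

shape : LTree → Tree
shape (lleaf _) = leaf
shape (lnode l r) = node (shape l) (shape r)

labels : LTree → List ℕ
labels (lleaf k) = k ∷ []
labels (lnode l r) = labels l ++ labels r

leftmost : LTree → ℕ
leftmost (lleaf k) = k
leftmost (lnode l r) = leftmost l

rightmost : LTree → ℕ
rightmost (lleaf k) = k
rightmost (lnode l r) = rightmost r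

MinMaxCond : LTree → Set
MinMaxCond (lleaf _) = ⊤
MinMaxCond t@(lnode l r) =
  MinMaxCond l × MinMaxCond r ×
  All (λ x → leftmost t ≤ x) (labels t) × All (λ x → x ≤ rightmost t) (labels t)

AdmissibleLabeling : Tree → LTree → Set
AdmissibleLabeling T ℓ =
  shape ℓ ≡ T ×
  All (λ x → 1 ≤ x × x ≤ leaves T) (labels ℓ) ×
  Unique (labels ℓ) ×
  MinMaxCond ℓ

-- Removing a removable leaf.  The Bool argument is ε(v) of the current
-- inner vertex v: true for ε = 1 (v adjacent to the root edge, or a right
-- child), false for ε = -1 (v a left child).

removeHere : Bool → ℕ → LTree → LTree → Maybe LTree
removeHere true  k (lleaf j) r = if j ≡ᵇ k then just r else nothing
removeHere true  k (lnode _ _) r = nothing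
removeHere false k l (lleaf j) = if j ≡ᵇ k then just l else nothing
removeHere false k l (lnode _ _) = nothing

remove : Bool → ℕ → LTree → Maybe LTree
remove e k (lleaf _) = nothing
remove e k (lnode l r) =
  removeHere e k l r
  <∣> (Maybe.map (λ l′ → lnode l′ r) (remove false k l)
  <∣> Maybe.map (λ r′ → lnode l r′) (remove true k r))

removeLeaf : ℕ → LTree → Maybe LTree
removeLeaf = remove true

validRemoval : LTree → List ℕ → Bool
validRemoval t [] = true
validRemoval t (k ∷ ks) with removeLeaf k t
... | just t′ = validRemoval t′ ks
... | nothing = false

-- Permutations of {1,…,m} in one-line notation (σ(1), …, σ(m)):
-- injective lists of length m with entries in {1,…,m}.

allLists : ℕ → ℕ → List (List ℕ)
allLists m zero = [] ∷ []
allLists m (suc k) =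
  concatMap (λ x → map (x ∷_) (allLists m k)) (map suc (upTo m))

Sym : ℕ → List (List ℕ)
Sym m = filter unique? (allLists m m)

descents : List ℕ → ℕ
descents (x ∷ y ∷ xs) = (if y <ᵇ x then 1 else 0) + descents (y ∷ xs)
descents _ = 0

-- E(T,ℓ,d) = |{σ ∈ S(T,ℓ) : d_σ = d}|, where n is the number of leaves
-- and S(T,ℓ) ⊂ S_{n-1}.
E : ℕ → LTree → ℕ → ℕ
E n ℓ d =
  length (filter (λ σ → T? (validRemoval ℓ σ) ×-dec (descents σ ≟ d))
                 (Sym (n ∸ 1)))

-- Let τ be the transposition of the labels k and k+1, where k+1 < n (the label n is never
-- removed and stays at the rightmost leaf). If both ℓ and τℓ are admissible, then
-- E(T,ℓ,d) = E(T,τℓ,d): on S_{n-1} take the involution that fixes σ when k and k+1 are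
-- adjacent in σ and composes σ with τ otherwise. In the second case σ ∈ S(T,ℓ) iff τσ ∈ S(T,τℓ),
-- and τ changes no descent. In the first case the descents are those of σ, and the removals of
-- k and k+1 commute because these two leaves never form a cherry: in either order the cherry
-- would violate the min/max condition of ℓ or of τℓ.
--
-- Any admissible labelling can be brought to the reading order 1, …, n by such transpositions,
-- bubbling 1, 2, … into place: transposing k and k+1 when k+1 precedes k never violates the
-- min/max condition. Two admissible labellings of T thus reach the same labelling.

module Submission where

open import Defs
open import Data.Nat using (ℕ; zero; suc; _+_; _≤_; _<_; _∸_; _≡ᵇ_; _<ᵇ_; z≤n; s≤s)
open import Data.Nat.Properties
open import Data.Bool using (Bool; true; false; T; if_then_else_)
open import Data.Bool.Properties using (T-≡; ⇔→≡)
open import Data.Maybe using (just; nothing)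
open import Data.List
  using (List; []; _∷_; _++_; map; length; filter; upTo; concatMap; cartesianProductWith)
open import Data.List.Properties
  using (map-++; map-id-local; length-++; length-map; length-upTo; ∷-injective; ++-assoc; ++-identityʳ; upTo-∷ʳ)
open import Data.List.Membership.Propositional using (_∈_; _∉_)
open import Data.List.Membership.Propositional.Properties
  using (∈-++⁺ˡ; ∈-++⁺ʳ; ∈-++⁻; ∈-∃++; ∈-map⁻; ∈-map⁺; ∈-filter⁻; ∈-filter⁺; ∈-upTo⁻; ∈-upTo⁺;
         ∈-cartesianProductWith⁻; ∈-cartesianProductWith⁺)
open import Data.List.Relation.Unary.Any using (here; there)
open import Data.List.Relation.Unary.All using (All; []; _∷_)
open import Data.List.Relation.Unary.All.Properties using (anti-mono; All¬⇒¬Any; ++⁻ˡ; ++⁻ʳ)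
import Data.List.Relation.Unary.All as All
import Data.List.Relation.Unary.All.Properties as Allₚ
open import Data.List.Relation.Binary.Sublist.Propositional using (_⊆_; _∷_; _∷ʳ_; from∈; to∈)
open import Data.List.Relation.Binary.Sublist.Propositional.Properties using (++⁺; ++⁺ˡ; ++⁺ʳ; ∷ˡ⁻)
open import Data.List.Relation.Unary.Unique.Propositional using (Unique)
open import Data.List.Relation.Unary.Unique.Propositional.Properties using (map⁺; filter⁺; upTo⁺; cartesianProductWith⁺)
open import Data.List.Relation.Unary.Unique.DecPropositional _≟_ using (unique?)
open import Data.List.Membership.DecPropositional _≟_ using (_∈?_)
open import Data.List.Relation.Unary.AllPairs using ([]; _∷_)
open import Data.Product using (∃; ∃₂; _×_; _,_; proj₁; proj₂)
open import Data.Sum using (_⊎_; inj₁; inj₂; [_,_]′)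
open import Data.Unit using (⊤; tt)
open import Data.Empty using (⊥-elim)
open import Function using (_∘_; Equivalence; mk⇔)
open import Relation.Nullary using (¬_; Dec; yes; no)
open import Relation.Nullary.Decidable using (map′; _×-dec_; _⊎-dec_)
open import Relation.Unary using (Decidable)
open import Relation.Binary.PropositionalEquality
open import Relation.Binary.Construct.Closure.ReflexiveTransitive using (Star; ε; _◅_; _◅◅_)

-- Transpositions and relabelling

transpose : ℕ → ℕ → ℕ
transpose k x with x ≟ k | x ≟ suc k
... | yes _ | _     = suc k
... | no _  | yes _ = k
... | no _  | no _  = x

transpose-k : ∀ k → transpose k k ≡ suc k
transpose-k k rewrite ≟-diag {k} refl = refl

transpose-suc : ∀ k → transpose k (suc k) ≡ k
transpose-suc k with suc k ≟ k
... | yes sk≡k = ⊥-elim (1+n≢n sk≡k)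
... | no _ rewrite ≟-diag {suc k} refl = refl

transpose-other : ∀ k {x} → x ≢ k → x ≢ suc k → transpose k x ≡ x
transpose-other k {x} x≢k x≢sk with x ≟ k | x ≟ suc k
... | yes x≡k | _         = ⊥-elim (x≢k x≡k)
... | no _    | yes x≡sk  = ⊥-elim (x≢sk x≡sk)
... | no _    | no _      = refl

transpose-involutive : ∀ k x → transpose k (transpose k x) ≡ x
transpose-involutive k x with x ≟ k | x ≟ suc k
... | yes refl | _        = transpose-suc k
... | no _     | yes refl = transpose-k k
... | no x≢k   | no x≢sk  = transpose-other k x≢k x≢sk

transpose-injective : ∀ k {x y} → transpose k x ≡ transpose k y → x ≡ y
transpose-injective k {x} {y} eq = begin
  x                             ≡⟨ transpose-involutive k x ⟨
  transpose k (transpose k x)   ≡⟨ cong (transpose k) eq ⟩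
  transpose k (transpose k y)   ≡⟨ transpose-involutive k y ⟩
  y                             ∎
  where open ≡-Reasoning

map-transpose-involutive : ∀ k σ → map (transpose k) (map (transpose k) σ) ≡ σ
map-transpose-involutive k []      = refl
map-transpose-involutive k (x ∷ σ) = cong₂ _∷_ (transpose-involutive k x) (map-transpose-involutive k σ)

transpose-mono-≤ : ∀ k {x y} → x ≤ y → ¬ (x ≡ k × y ≡ suc k) → transpose k x ≤ transpose k y
transpose-mono-≤ k {x} {y} x≤y ¬kk with x ≟ k | x ≟ suc k | y ≟ k | y ≟ suc k
... | yes _    | _        | yes _   | _        = ≤-refl
... | yes refl | _        | no _    | yes refl = ⊥-elim (¬kk (refl , refl))
... | yes refl | _        | no y≢k  | no _     = ≤∧≢⇒< x≤y (y≢k ∘ sym)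
... | no _     | yes refl | yes refl | _       = ⊥-elim (1+n≰n x≤y)
... | no _     | yes _    | no _    | yes _    = ≤-refl
... | no _     | yes refl | no _    | no _     = ≤-trans (n≤1+n k) x≤y
... | no _     | no _     | yes refl | _       = ≤-trans x≤y (n≤1+n y)
... | no _     | no x≢sk  | no _    | yes refl = ≤-pred (≤∧≢⇒< x≤y x≢sk)
... | no _     | no _     | no _    | no _     = x≤y

transpose-mono-< : ∀ k {x y} → x < y → ¬ (x ≡ k × y ≡ suc k) → transpose k x < transpose k y
transpose-mono-< k x<y ¬kk =
  ≤∧≢⇒< (transpose-mono-≤ k (<⇒≤ x<y) ¬kk) (<⇒≢ x<y ∘ transpose-injective k)

relabel : (ℕ → ℕ) → LTree → LTree
relabel f (lleaf x)   = lleaf (f x)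
relabel f (lnode l r) = lnode (relabel f l) (relabel f r)

shape-relabel : ∀ f t → shape (relabel f t) ≡ shape t
shape-relabel f (lleaf x)   = refl
shape-relabel f (lnode l r) = cong₂ node (shape-relabel f l) (shape-relabel f r)

labels-relabel : ∀ f t → labels (relabel f t) ≡ map f (labels t)
labels-relabel f (lleaf x)   = refl
labels-relabel f (lnode l r) = begin
  labels (relabel f l) ++ labels (relabel f r) ≡⟨ cong₂ _++_ (labels-relabel f l) (labels-relabel f r) ⟩
  map f (labels l) ++ map f (labels r)         ≡⟨ map-++ f (labels l) (labels r) ⟨
  map f (labels l ++ labels r)                 ∎
  where open ≡-Reasoning

leftmost-relabel : ∀ f t → leftmost (relabel f t) ≡ f (leftmost t)
leftmost-relabel f (lleaf x)   = refl
leftmost-relabel f (lnode l r) = leftmost-relabel f l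

rightmost-relabel : ∀ f t → rightmost (relabel f t) ≡ f (rightmost t)
rightmost-relabel f (lleaf x)   = refl
rightmost-relabel f (lnode l r) = rightmost-relabel f r

Unique-relabel : ∀ {f} → (∀ {x y} → f x ≡ f y → x ≡ y) → ∀ t → Unique (labels t) → Unique (labels (relabel f t))
Unique-relabel f-injective t u = subst Unique (sym (labels-relabel _ t)) (map⁺ f-injective u)

relabel-inverse : ∀ {f g} → (∀ x → f (g x) ≡ x) → ∀ t → relabel f (relabel g t) ≡ t
relabel-inverse f∘g≡id (lleaf x)   = cong lleaf (f∘g≡id x)
relabel-inverse f∘g≡id (lnode l r) = cong₂ lnode (relabel-inverse f∘g≡id l) (relabel-inverse f∘g≡id r)

-- Removal of leaves

data Removes : Bool → ℕ → LTree → LTree → Set where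
  removeLeft  : ∀ {k r}          → Removes true  k (lnode (lleaf k) r) r
  removeRight : ∀ {k l}          → Removes false k (lnode l (lleaf k)) l
  inLeft      : ∀ {e k l l′ r}   → Removes false k l l′ → Removes e k (lnode l r) (lnode l′ r)
  inRight     : ∀ {e k l r r′}   → Removes true  k r r′ → Removes e k (lnode l r) (lnode l r′)

Removes-relabel : ∀ f {e k t t′} → Removes e k t t′ → Removes e (f k) (relabel f t) (relabel f t′)
Removes-relabel f removeLeft  = removeLeft
Removes-relabel f removeRight = removeRight
Removes-relabel f (inLeft p)  = inLeft (Removes-relabel f p)
Removes-relabel f (inRight p) = inRight (Removes-relabel f p)

Removes-∈ : ∀ {e k t t′} → Removes e k t t′ → k ∈ labels t
Removes-∈ removeLeft                    = here refl
Removes-∈ {t = lnode l _} removeRight   = ∈-++⁺ʳ (labels l) (here refl)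
Removes-∈ (inLeft p)                    = ∈-++⁺ˡ (Removes-∈ p)
Removes-∈ {t = lnode l _} (inRight p)   = ∈-++⁺ʳ (labels l) (Removes-∈ p)

Removes-⊆ : ∀ {e k t t′} → Removes e k t t′ → ∀ {x} → x ∈ labels t′ → x ∈ labels t
Removes-⊆ removeLeft  x∈ = there x∈
Removes-⊆ removeRight x∈ = ∈-++⁺ˡ x∈
Removes-⊆ {t = lnode l r} (inLeft {l′ = l′} p) x∈ with ∈-++⁻ (labels l′) x∈
... | inj₁ x∈l′ = ∈-++⁺ˡ (Removes-⊆ p x∈l′)
... | inj₂ x∈r  = ∈-++⁺ʳ (labels l) x∈r
Removes-⊆ {t = lnode l r} (inRight p) x∈ with ∈-++⁻ (labels l) x∈
... | inj₁ x∈l  = ∈-++⁺ˡ x∈l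
... | inj₂ x∈r′ = ∈-++⁺ʳ (labels l) (Removes-⊆ p x∈r′)

Distinct : LTree → Set
Distinct (lleaf _)   = ⊤
Distinct (lnode l r) = Distinct l × Distinct r × (∀ {x} → x ∈ labels l → x ∉ labels r)

Unique-++⁻ : ∀ {A : Set} (xs : List A) {ys} → Unique (xs ++ ys) → Unique xs × Unique ys × (∀ {x} → x ∈ xs → x ∉ ys)
Unique-++⁻ []       u         = [] , u , λ ()
Unique-++⁻ (x ∷ xs) (x∉ ∷ u) with Unique-++⁻ xs u
... | u₁ , u₂ , disjoint =
  ++⁻ˡ xs x∉ ∷ u₁ , u₂ , λ { (here refl) → All¬⇒¬Any (++⁻ʳ xs x∉) ; (there x∈) → disjoint x∈ }

Unique⇒Distinct : ∀ t → Unique (labels t) → Distinct t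
Unique⇒Distinct (lleaf _)   _ = tt
Unique⇒Distinct (lnode l r) u with Unique-++⁻ (labels l) u
... | ul , ur , disjoint = Unique⇒Distinct l ul , Unique⇒Distinct r ur , disjoint

Removes-Distinct : ∀ {e k t t′} → Removes e k t t′ → Distinct t → Distinct t′
Removes-Distinct removeLeft  (_ , dr , _)        = dr
Removes-Distinct removeRight (dl , _ , _)        = dl
Removes-Distinct (inLeft p)  (dl , dr , l#r) = Removes-Distinct p dl , dr , l#r ∘ Removes-⊆ p
Removes-Distinct (inRight p) (dl , dr , l#r) = dl , Removes-Distinct p dr , λ x∈l → l#r x∈l ∘ Removes-⊆ p

≡ᵇ-true⇒≡ : ∀ j k → (j ≡ᵇ k) ≡ true → j ≡ k
≡ᵇ-true⇒≡ j k eq = ≡ᵇ⇒≡ j k (Equivalence.from T-≡ eq)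

≡ᵇ-refl : ∀ k → (k ≡ᵇ k) ≡ true
≡ᵇ-refl k = Equivalence.to T-≡ (≡⇒≡ᵇ k k refl)

removeHere-sound : ∀ e k l r {t′} → removeHere e k l r ≡ just t′ → Removes e k (lnode l r) t′
removeHere-sound true  k (lleaf j) r eq with j ≡ᵇ k in j≡ᵇk
removeHere-sound true  k (lleaf j) r refl | true with refl ← ≡ᵇ-true⇒≡ j k j≡ᵇk = removeLeft
removeHere-sound false k l (lleaf j) eq with j ≡ᵇ k in j≡ᵇk
removeHere-sound false k l (lleaf j) refl | true with refl ← ≡ᵇ-true⇒≡ j k j≡ᵇk = removeRight

remove-sound : ∀ e k t {t′} → remove e k t ≡ just t′ → Removes e k t t′
remove-sound e k (lnode l r) eq
  with removeHere e k l r in here≡ | remove false k l in left≡ | remove true k r in right≡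
... | just _  | _       | _       = removeHere-sound e k l r (trans here≡ eq)
remove-sound e k (lnode l r) refl | nothing | just _  | _      = inLeft  (remove-sound false k l left≡)
remove-sound e k (lnode l r) refl | nothing | nothing | just _ = inRight (remove-sound true k r right≡)

remove-∉ : ∀ e k t → k ∉ labels t → remove e k t ≡ nothing
remove-∉ e k t k∉ with remove e k t in eq
... | just _  = ⊥-elim (k∉ (Removes-∈ (remove-sound e k t eq)))
... | nothing = refl

removeHere-nothing : ∀ e k l r → l ≢ lleaf k → r ≢ lleaf k → removeHere e k l r ≡ nothing
removeHere-nothing true k (lleaf j) r l≢k _ with j ≡ᵇ k in j≡ᵇk
... | true  = ⊥-elim (l≢k (cong lleaf (≡ᵇ-true⇒≡ j k j≡ᵇk)))
... | false = refl
removeHere-nothing true  k (lnode _ _) r _ _ = refl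
removeHere-nothing false k l (lleaf j) _ r≢k with j ≡ᵇ k in j≡ᵇk
... | true  = ⊥-elim (r≢k (cong lleaf (≡ᵇ-true⇒≡ j k j≡ᵇk)))
... | false = refl
removeHere-nothing false k l (lnode _ _) _ _ = refl

¬Removes-lleaf : ∀ {e k j t′} → ¬ Removes e k (lleaf j) t′
¬Removes-lleaf ()

≡lleaf⇒∈ : ∀ {t k} → t ≡ lleaf k → k ∈ labels t
≡lleaf⇒∈ refl = here refl

remove-complete : ∀ {e k t t′} → Distinct t → Removes e k t t′ → remove e k t ≡ just t′
remove-complete {k = k} _ removeLeft  rewrite ≡ᵇ-refl k = refl
remove-complete {k = k} _ removeRight rewrite ≡ᵇ-refl k = refl
remove-complete {e} {k} (dl , _ , l#r) (inLeft {l = l} {r = r} p)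
  rewrite removeHere-nothing e k l r (λ { refl → ¬Removes-lleaf p }) (l#r (Removes-∈ p) ∘ ≡lleaf⇒∈)
        | remove-complete dl p = refl
remove-complete {e} {k} (_ , dr , l#r) (inRight {l = l} {r = r} p)
  rewrite removeHere-nothing e k l r (λ l≡k → l#r (≡lleaf⇒∈ l≡k) (Removes-∈ p)) (λ { refl → ¬Removes-lleaf p })
        | remove-∉ false k l (λ k∈l → l#r k∈l (Removes-∈ p))
        | remove-complete dr p = refl

data RemovalSequence : LTree → List ℕ → Set where
  []  : ∀ {t} → RemovalSequence t []
  _∷_ : ∀ {t t′ k σ} → Removes true k t t′ → RemovalSequence t′ σ → RemovalSequence t (k ∷ σ)

validRemoval-sound : ∀ t σ → T (validRemoval t σ) → RemovalSequence t σ
validRemoval-sound t []      _ = []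
validRemoval-sound t (k ∷ σ) v with removeLeaf k t in eq
... | just t′ = remove-sound true k t eq ∷ validRemoval-sound t′ σ v

validRemoval-complete : ∀ {t σ} → Distinct t → RemovalSequence t σ → T (validRemoval t σ)
validRemoval-complete d []       = tt
validRemoval-complete d (p ∷ ps) rewrite remove-complete d p = validRemoval-complete (Removes-Distinct p d) ps

RemovalSequence-relabel : ∀ f {t σ} → RemovalSequence t σ → RemovalSequence (relabel f t) (map f σ)
RemovalSequence-relabel f []       = []
RemovalSequence-relabel f (p ∷ ps) = Removes-relabel f p ∷ RemovalSequence-relabel f ps

Removes-leftmost : ∀ {k t t′} → Removes false k t t′ → leftmost t′ ≡ leftmost t
Removes-leftmost removeRight = refl
Removes-leftmost (inLeft p)  = Removes-leftmost p
Removes-leftmost (inRight p) = refl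

Removes-rightmost : ∀ {k t t′} → Removes true k t t′ → rightmost t′ ≡ rightmost t
Removes-rightmost removeLeft  = refl
Removes-rightmost (inLeft p)  = refl
Removes-rightmost (inRight p) = Removes-rightmost p

Removes-MinMaxCond : ∀ {e k t t′} → Removes e k t t′ → MinMaxCond t → MinMaxCond t′
Removes-MinMaxCond removeLeft  (_ , mr , _) = mr
Removes-MinMaxCond removeRight (ml , _ , _) = ml
Removes-MinMaxCond q@(inLeft p) (ml , mr , lo , hi) =
  Removes-MinMaxCond p ml , mr ,
  subst (λ m → All (m ≤_) _) (sym (Removes-leftmost p)) (anti-mono (Removes-⊆ q) lo) ,
  anti-mono (Removes-⊆ q) hi
Removes-MinMaxCond q@(inRight p) (ml , mr , lo , hi) =
  ml , Removes-MinMaxCond p mr ,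
  anti-mono (Removes-⊆ q) lo ,
  subst (λ m → All (_≤ m) _) (sym (Removes-rightmost p)) (anti-mono (Removes-⊆ q) hi)

data Cherry (a b : ℕ) : LTree → Set where
  cherry  : Cherry a b (lnode (lleaf a) (lleaf b))
  inLeft  : ∀ {l r} → Cherry a b l → Cherry a b (lnode l r)
  inRight : ∀ {l r} → Cherry a b r → Cherry a b (lnode l r)

Cherry-relabel : ∀ f {a b t} → Cherry a b t → Cherry (f a) (f b) (relabel f t)
Cherry-relabel f cherry      = cherry
Cherry-relabel f (inLeft c)  = inLeft (Cherry-relabel f c)
Cherry-relabel f (inRight c) = inRight (Cherry-relabel f c)

Cherry-MinMaxCond : ∀ {a b t} → MinMaxCond t → Cherry a b t → a ≤ b
Cherry-MinMaxCond (_ , _ , (_ ∷ a≤b ∷ []) , _) cherry = a≤b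
Cherry-MinMaxCond (ml , _ , _) (inLeft c)  = Cherry-MinMaxCond ml c
Cherry-MinMaxCond (_ , mr , _) (inRight c) = Cherry-MinMaxCond mr c

Removes-commute : ∀ {e a b t t₁ t₂} → ¬ Cherry a b t → ¬ Cherry b a t →
                  Removes e a t t₁ → Removes e b t₁ t₂ → ∃ λ t₃ → Removes e b t t₃ × Removes e a t₃ t₂
Removes-commute _ _ removeLeft  q = _ , inRight q , removeLeft
Removes-commute _ _ removeRight q = _ , inLeft q , removeRight
Removes-commute _ ¬ba (inLeft removeRight) removeLeft = ⊥-elim (¬ba (inLeft cherry))
Removes-commute _ _ (inLeft p) removeRight = _ , removeRight , p
Removes-commute ¬ab ¬ba (inLeft p) (inLeft q) with Removes-commute (¬ab ∘ inLeft) (¬ba ∘ inLeft) p q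
... | _ , q′ , p′ = _ , inLeft q′ , inLeft p′
Removes-commute _ _ (inLeft p) (inRight q) = _ , inRight q , inLeft p
Removes-commute _ _ (inRight p) removeLeft = _ , removeLeft , p
Removes-commute ¬ab _ (inRight removeLeft) removeRight = ⊥-elim (¬ab (inRight cherry))
Removes-commute _ _ (inRight p) (inLeft q) = _ , inLeft q , inRight p
Removes-commute ¬ab ¬ba (inRight p) (inRight q) with Removes-commute (¬ab ∘ inRight) (¬ba ∘ inRight) p q
... | _ , q′ , p′ = _ , inRight q′ , inRight p′

-- Counting

length-≤-Unique : ∀ {A : Set} {xs ys : List A} → Unique xs → (∀ {x} → x ∈ xs → x ∈ ys) → length xs ≤ length ys
length-≤-Unique []                     _     = z≤n
length-≤-Unique {xs = x ∷ xs} (x∉ ∷ u) xs⊆ys with ∈-∃++ (xs⊆ys (here refl))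
... | ys₁ , ys₂ , refl = begin
  suc (length xs)              ≤⟨ s≤s (length-≤-Unique u xs⊆ys₁++ys₂) ⟩
  suc (length (ys₁ ++ ys₂))    ≡⟨ cong suc (length-++ ys₁) ⟩
  suc (length ys₁ + length ys₂) ≡⟨ +-suc (length ys₁) (length ys₂) ⟨
  length ys₁ + length (x ∷ ys₂) ≡⟨ length-++ ys₁ ⟨
  length (ys₁ ++ x ∷ ys₂)      ∎
  where
  open ≤-Reasoning
  xs⊆ys₁++ys₂ : ∀ {z} → z ∈ xs → z ∈ ys₁ ++ ys₂
  xs⊆ys₁++ys₂ z∈ with ∈-++⁻ ys₁ (xs⊆ys (there z∈))
  ... | inj₁ z∈ys₁         = ∈-++⁺ˡ z∈ys₁
  ... | inj₂ (here refl)   = ⊥-elim (All¬⇒¬Any x∉ z∈)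
  ... | inj₂ (there z∈ys₂) = ∈-++⁺ʳ ys₁ z∈ys₂

length-filter-≤ : ∀ {A : Set} {P Q : A → Set} (P? : Decidable P) (Q? : Decidable Q) {xs} (g : A → A) →
                  Unique xs → (∀ {x y} → g x ≡ g y → x ≡ y) →
                  (∀ {x} → x ∈ xs → P x → g x ∈ xs × Q (g x)) →
                  length (filter P? xs) ≤ length (filter Q? xs)
length-filter-≤ P? Q? {xs} g u g-injective g-maps = begin
  length (filter P? xs)         ≡⟨ length-map g (filter P? xs) ⟨
  length (map g (filter P? xs)) ≤⟨ length-≤-Unique (map⁺ g-injective (filter⁺ P? u)) image⊆ ⟩
  length (filter Q? xs)         ∎
  where
  open ≤-Reasoning
  image⊆ : ∀ {y} → y ∈ map g (filter P? xs) → y ∈ filter Q? xs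
  image⊆ y∈ with ∈-map⁻ g y∈
  ... | x , x∈ , refl with ∈-filter⁻ P? x∈
  ... | x∈xs , px with g-maps x∈xs px
  ... | gx∈ , qgx = ∈-filter⁺ Q? gx∈ qgx

range : ℕ → List ℕ
range m = map suc (upTo m)

∈-range⁻ : ∀ {m x} → x ∈ range m → 1 ≤ x × x ≤ m
∈-range⁻ x∈ with ∈-map⁻ suc x∈
... | i , i∈ , refl = s≤s z≤n , ∈-upTo⁻ i∈

∈-range⁺ : ∀ {m x} → 1 ≤ x → x ≤ m → x ∈ range m
∈-range⁺ {x = suc i} _ i<m = ∈-map⁺ suc (∈-upTo⁺ i<m)

Unique-range : ∀ m → Unique (range m)
Unique-range m = map⁺ suc-injective (upTo⁺ m)

length-range : ∀ m → length (range m) ≡ m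
length-range m = trans (length-map suc (upTo m)) (length-upTo m)

range-suc : ∀ m zs → range m ++ suc m ∷ zs ≡ range (suc m) ++ zs
range-suc m zs = begin
  range m ++ suc m ∷ zs             ≡⟨ ++-assoc (range m) (suc m ∷ []) zs ⟨
  (range m ++ suc m ∷ []) ++ zs     ≡⟨ cong (_++ zs) (map-++ suc (upTo m) (m ∷ [])) ⟨
  map suc (upTo m ++ m ∷ []) ++ zs  ≡⟨ cong (λ xs → map suc xs ++ zs) (upTo-∷ʳ m) ⟩
  range (suc m) ++ zs               ∎
  where open ≡-Reasoning

range-∉ : ∀ {m x} → m < x → x ∉ range m
range-∉ m<x x∈ = <⇒≱ m<x (proj₂ (∈-range⁻ x∈))

allLists-suc : ∀ m j → allLists m (suc j) ≡ cartesianProductWith _∷_ (range m) (allLists m j)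
allLists-suc m j = go (range m)
  where
  go : ∀ xs → concatMap (λ x → map (x ∷_) (allLists m j)) xs ≡ cartesianProductWith _∷_ xs (allLists m j)
  go []       = refl
  go (x ∷ xs) = cong (map (x ∷_) (allLists m j) ++_) (go xs)

Unique-allLists : ∀ m j → Unique (allLists m j)
Unique-allLists m zero    = [] ∷ []
Unique-allLists m (suc j) rewrite allLists-suc m j =
  cartesianProductWith⁺ _∷_ ∷-injective (Unique-range m) (Unique-allLists m j)

allLists-map : ∀ {m} f → (∀ {x} → x ∈ range m → f x ∈ range m) →
               ∀ j {σ} → σ ∈ allLists m j → map f σ ∈ allLists m j
allLists-map f f-range zero    (here refl) = here refl
allLists-map {m} f f-range (suc j) σ∈ rewrite allLists-suc m j
  with ∈-cartesianProductWith⁻ _∷_ (range m) (allLists m j) σ∈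
... | x , σ′ , x∈ , σ′∈ , refl = ∈-cartesianProductWith⁺ _∷_ (f-range x∈) (allLists-map f f-range j σ′∈)

Unique-Sym : ∀ m → Unique (Sym m)
Unique-Sym m = filter⁺ unique? (Unique-allLists m m)

Sym-Unique : ∀ {m σ} → σ ∈ Sym m → Unique σ
Sym-Unique {m} σ∈ = proj₂ (∈-filter⁻ unique? {xs = allLists m m} σ∈)

transpose-bounded : ∀ {k m x} → 1 ≤ k → suc k ≤ m → 1 ≤ x × x ≤ m → 1 ≤ transpose k x × transpose k x ≤ m
transpose-bounded {k} {m} {x} 1≤k sk≤m x-bounded with x ≟ k | x ≟ suc k
... | yes _ | _     = s≤s z≤n , sk≤m
... | no _  | yes _ = 1≤k , ≤-trans (n≤1+n k) sk≤m
... | no _  | no _  = x-bounded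

Sym-transpose : ∀ {k m σ} → 1 ≤ k → suc k ≤ m → σ ∈ Sym m → map (transpose k) σ ∈ Sym m
Sym-transpose {k} {m} 1≤k sk≤m σ∈ with ∈-filter⁻ unique? {xs = allLists m m} σ∈
... | σ∈allLists , u = ∈-filter⁺ unique?
  (allLists-map (transpose k) τ-range m σ∈allLists) (map⁺ (transpose-injective k) u)
  where
  τ-range : ∀ {x} → x ∈ range m → transpose k x ∈ range m
  τ-range x∈ with transpose-bounded 1≤k sk≤m (∈-range⁻ x∈)
  ... | 1≤τx , τx≤m = ∈-range⁺ 1≤τx τx≤m

-- Invariance of E under a transposition of labels

data Transposed (k : ℕ) : ℕ → ℕ → Set where
  up   : Transposed k k (suc k)
  down : Transposed k (suc k) k

Transposed-sym : ∀ {k a b} → Transposed k a b → Transposed k b a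
Transposed-sym up   = down
Transposed-sym down = up

transpose-Transposed : ∀ {k a b} → Transposed k a b → transpose k a ≡ b
transpose-Transposed {k} up   = transpose-k k
transpose-Transposed {k} down = transpose-suc k

no-transposed-cherry : ∀ {k a b t} → MinMaxCond t → MinMaxCond (relabel (transpose k) t) →
                       Transposed k a b → ¬ Cherry a b t
no-transposed-cherry {k} mm mm′ up c =
  1+n≰n (subst₂ _≤_ (transpose-k k) (transpose-suc k) (Cherry-MinMaxCond mm′ (Cherry-relabel (transpose k) c)))
no-transposed-cherry mm mm′ down c = 1+n≰n (Cherry-MinMaxCond mm c)

data Adjacent (k : ℕ) : List ℕ → Set where
  here  : ∀ {a b σ} → Transposed k a b → Adjacent k (a ∷ b ∷ σ)
  there : ∀ {x σ} → Adjacent k σ → Adjacent k (x ∷ σ)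

Adjacent-∈ : ∀ {k σ} → Adjacent k σ → k ∈ σ × suc k ∈ σ
Adjacent-∈ (here up)   = here refl , there (here refl)
Adjacent-∈ (here down) = there (here refl) , here refl
Adjacent-∈ (there adj) with Adjacent-∈ adj
... | k∈ , sk∈ = there k∈ , there sk∈

map-transpose-∉ : ∀ {k a b xs} → Transposed k a b → a ∉ xs → b ∉ xs → map (transpose k) xs ≡ xs
map-transpose-∉ {k} up k∉ sk∉ =
  map-id-local (All.tabulate λ x∈ → transpose-other k (λ { refl → k∉ x∈ }) (λ { refl → sk∉ x∈ }))
map-transpose-∉ down sk∉ k∉ = map-transpose-∉ up k∉ sk∉

RemovalSequence-transpose : ∀ {k t σ} → Unique σ → Adjacent k σ →
                            MinMaxCond t → MinMaxCond (relabel (transpose k) t) →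
                            RemovalSequence t σ → RemovalSequence t (map (transpose k) σ)
RemovalSequence-transpose {k} {t} {a ∷ b ∷ β} ((_ ∷ a∉) ∷ (b∉ ∷ _)) (here ab) mm mm′ (p ∷ q ∷ ps)
  with Removes-commute (no-transposed-cherry mm mm′ ab) (no-transposed-cherry mm mm′ (Transposed-sym ab)) p q
... | _ , q′ , p′ = subst (RemovalSequence t) (sym τσ≡) (q′ ∷ p′ ∷ ps)
  where
  τσ≡ : map (transpose k) (a ∷ b ∷ β) ≡ b ∷ a ∷ β
  τσ≡ = cong₂ _∷_ (transpose-Transposed ab)
          (cong₂ _∷_ (transpose-Transposed (Transposed-sym ab)) (map-transpose-∉ ab (All¬⇒¬Any a∉) (All¬⇒¬Any b∉)))
RemovalSequence-transpose {k} {t} {x ∷ _} (x∉ ∷ u) (there adj) mm mm′ (p ∷ ps) =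
  subst (λ y → RemovalSequence t (y ∷ _)) (sym τx≡x)
    (p ∷ RemovalSequence-transpose u adj (Removes-MinMaxCond p mm)
           (Removes-MinMaxCond (Removes-relabel (transpose k) p) mm′) ps)
  where
  τx≡x : transpose k x ≡ x
  τx≡x = transpose-other k (λ { refl → All¬⇒¬Any x∉ (proj₁ (Adjacent-∈ adj)) })
                           (λ { refl → All¬⇒¬Any x∉ (proj₂ (Adjacent-∈ adj)) })

<ᵇ-transpose : ∀ k {x y} → ¬ Transposed k x y → (transpose k y <ᵇ transpose k x) ≡ (y <ᵇ x)
<ᵇ-transpose k {x} {y} ¬xy = ⇔→≡ {z = true} (mk⇔ (reflect backward) (reflect forward))
  where
  reflect : ∀ {m n m′ n′} → (m < n → m′ < n′) → (m <ᵇ n) ≡ true → (m′ <ᵇ n′) ≡ true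
  reflect f eq = Equivalence.to T-≡ (<⇒<ᵇ (f (<ᵇ⇒< _ _ (Equivalence.from T-≡ eq))))
  forward : y < x → transpose k y < transpose k x
  forward y<x = transpose-mono-< k y<x λ { (refl , refl) → ¬xy down }
  backward : transpose k y < transpose k x → y < x
  backward τy<τx = subst₂ _<_ (transpose-involutive k y) (transpose-involutive k x)
    (transpose-mono-< k τy<τx λ (τy≡k , τx≡sk) → ¬xy (subst₂ (Transposed k)
      (transpose-injective k (trans (transpose-k k) (sym τx≡sk)))
      (transpose-injective k (trans (transpose-suc k) (sym τy≡k))) up))

descents-transpose : ∀ k σ → ¬ Adjacent k σ → descents (map (transpose k) σ) ≡ descents σ
descents-transpose k []          _    = refl
descents-transpose k (x ∷ [])    _    = refl
descents-transpose k (x ∷ y ∷ σ) ¬adj =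
  cong₂ (λ b n → (if b then 1 else 0) + n)
    (<ᵇ-transpose k (¬adj ∘ here))
    (descents-transpose k (y ∷ σ) (¬adj ∘ there))

Transposed? : ∀ k a b → Dec (Transposed k a b)
Transposed? k a b = map′ from to ((a ≟ k ×-dec b ≟ suc k) ⊎-dec (a ≟ suc k ×-dec b ≟ k))
  where
  from : (a ≡ k × b ≡ suc k) ⊎ (a ≡ suc k × b ≡ k) → Transposed k a b
  from (inj₁ (refl , refl)) = up
  from (inj₂ (refl , refl)) = down
  to : Transposed k a b → (a ≡ k × b ≡ suc k) ⊎ (a ≡ suc k × b ≡ k)
  to up   = inj₁ (refl , refl)
  to down = inj₂ (refl , refl)

Adjacent? : ∀ k σ → Dec (Adjacent k σ)
Adjacent? k []          = no λ ()
Adjacent? k (x ∷ [])    = no λ { (there ()) }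
Adjacent? k (a ∷ b ∷ σ) = map′ [ here , there ]′ split (Transposed? k a b ⊎-dec Adjacent? k (b ∷ σ))
  where
  split : Adjacent k (a ∷ b ∷ σ) → Transposed k a b ⊎ Adjacent k (b ∷ σ)
  split (here ab)   = inj₁ ab
  split (there adj) = inj₂ adj

Adjacent-transpose : ∀ {k σ} → Adjacent k σ → Adjacent k (map (transpose k) σ)
Adjacent-transpose {k} (here ab) =
  here (subst₂ (Transposed k) (sym (transpose-Transposed ab)) (sym (transpose-Transposed (Transposed-sym ab)))
          (Transposed-sym ab))
Adjacent-transpose (there adj) = there (Adjacent-transpose adj)

exchange : ∀ k σ → Dec (Adjacent k σ) → List ℕ
exchange k σ (yes _) = σ
exchange k σ (no _)  = map (transpose k) σ

exchange-injective : ∀ k {σ σ′} → exchange k σ (Adjacent? k σ) ≡ exchange k σ′ (Adjacent? k σ′) → σ ≡ σ′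
exchange-injective k {σ} {σ′} eq with Adjacent? k σ | Adjacent? k σ′
... | yes _   | yes _    = eq
... | no _    | no _     = begin
  σ                                         ≡⟨ map-transpose-involutive k σ ⟨
  map (transpose k) (map (transpose k) σ)   ≡⟨ cong (map (transpose k)) eq ⟩
  map (transpose k) (map (transpose k) σ′)  ≡⟨ map-transpose-involutive k σ′ ⟩
  σ′                                        ∎
  where open ≡-Reasoning
... | yes adj | no ¬adj′ = ⊥-elim (¬adj′ (subst (Adjacent k)
  (trans (cong (map (transpose k)) eq) (map-transpose-involutive k σ′)) (Adjacent-transpose adj)))
... | no ¬adj | yes adj′ = ⊥-elim (¬adj (subst (Adjacent k)
  (trans (cong (map (transpose k)) (sym eq)) (map-transpose-involutive k σ)) (Adjacent-transpose adj′)))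

E-transpose-≤ : ∀ n d k ℓ → 1 ≤ k → suc k ≤ n ∸ 1 → Unique (labels ℓ) →
                MinMaxCond ℓ → MinMaxCond (relabel (transpose k) ℓ) →
                E n ℓ d ≤ E n (relabel (transpose k) ℓ) d
E-transpose-≤ n d k ℓ 1≤k sk≤n-1 u mm mm′ =
  length-filter-≤ _ _ (λ σ → exchange k σ (Adjacent? k σ)) (Unique-Sym (n ∸ 1)) (exchange-injective k) maps
  where
  ℓ′ : LTree
  ℓ′ = relabel (transpose k) ℓ
  distinct′ : Distinct ℓ′
  distinct′ = Unique⇒Distinct ℓ′ (Unique-relabel (transpose-injective k) ℓ u)
  maps : ∀ {σ} → σ ∈ Sym (n ∸ 1) → T (validRemoval ℓ σ) × descents σ ≡ d →
         let σ′ = exchange k σ (Adjacent? k σ) in σ′ ∈ Sym (n ∸ 1) × T (validRemoval ℓ′ σ′) × descents σ′ ≡ d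
  maps {σ} σ∈ (valid , dσ) with Adjacent? k σ
  ... | yes adj = σ∈ , validRemoval-complete distinct′ removable , dσ
    where
    removable : RemovalSequence ℓ′ σ
    removable = subst (RemovalSequence ℓ′) (map-transpose-involutive k σ)
      (RemovalSequence-relabel (transpose k)
        (RemovalSequence-transpose (Sym-Unique {n ∸ 1} σ∈) adj mm mm′ (validRemoval-sound ℓ σ valid)))
  ... | no ¬adj = Sym-transpose {m = n ∸ 1} 1≤k sk≤n-1 σ∈ ,
                  validRemoval-complete distinct′ (RemovalSequence-relabel (transpose k) (validRemoval-sound ℓ σ valid)) ,
                  trans (descents-transpose k σ ¬adj) dσ

E-transpose : ∀ n d k ℓ → 1 ≤ k → suc k ≤ n ∸ 1 → Unique (labels ℓ) →
              MinMaxCond ℓ → MinMaxCond (relabel (transpose k) ℓ) →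
              E n ℓ d ≡ E n (relabel (transpose k) ℓ) d
E-transpose n d k ℓ 1≤k sk≤n-1 u mm mm′ = ≤-antisym
  (E-transpose-≤ n d k ℓ 1≤k sk≤n-1 u mm mm′)
  (subst (λ t → E n ℓ′ d ≤ E n t d) ττℓ≡ℓ
    (E-transpose-≤ n d k ℓ′ 1≤k sk≤n-1 (Unique-relabel (transpose-injective k) ℓ u) mm′
      (subst MinMaxCond (sym ττℓ≡ℓ) mm)))
  where
  ℓ′ : LTree
  ℓ′ = relabel (transpose k) ℓ
  ττℓ≡ℓ : relabel (transpose k) ℓ′ ≡ ℓ
  ττℓ≡ℓ = relabel-inverse (transpose-involutive k) ℓ

-- Connecting admissible labellings

leftmost-∈ : ∀ t → leftmost t ∈ labels t
leftmost-∈ (lleaf x)   = here refl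
leftmost-∈ (lnode l r) = ∈-++⁺ˡ (leftmost-∈ l)

rightmost-∈ : ∀ t → rightmost t ∈ labels t
rightmost-∈ (lleaf x)   = here refl
rightmost-∈ (lnode l r) = ∈-++⁺ʳ (labels l) (rightmost-∈ r)

leftmost-first : ∀ t {y} → y ∈ labels t → y ≡ leftmost t ⊎ (leftmost t ∷ y ∷ []) ⊆ labels t
leftmost-first (lleaf x)   (here refl) = inj₁ refl
leftmost-first (lnode l r) y∈ with ∈-++⁻ (labels l) y∈
... | inj₂ y∈r = inj₂ (++⁺ (from∈ (leftmost-∈ l)) (from∈ y∈r))
... | inj₁ y∈l with leftmost-first l y∈l
...   | inj₁ y≡lm = inj₁ y≡lm
...   | inj₂ lm-y = inj₂ (++⁺ʳ (labels r) lm-y)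

rightmost-last : ∀ t {y} → y ∈ labels t → y ≡ rightmost t ⊎ (y ∷ rightmost t ∷ []) ⊆ labels t
rightmost-last (lleaf x)   (here refl) = inj₁ refl
rightmost-last (lnode l r) y∈ with ∈-++⁻ (labels l) y∈
... | inj₁ y∈l = inj₂ (++⁺ (from∈ y∈l) (from∈ (rightmost-∈ r)))
... | inj₂ y∈r with rightmost-last r y∈r
...   | inj₁ y≡rm = inj₁ y≡rm
...   | inj₂ y-rm = inj₂ (++⁺ˡ (labels l) y-rm)

MonotoneAlong : (ℕ → ℕ) → List ℕ → Set
MonotoneAlong f xs = ∀ {x y} → x ≤ y → (x ∷ y ∷ []) ⊆ xs → f x ≤ f y

MinMaxCond-relabel : ∀ f t → MonotoneAlong f (labels t) → MinMaxCond t → MinMaxCond (relabel f t)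
MinMaxCond-relabel f (lleaf x)       _    _                    = tt
MinMaxCond-relabel f t@(lnode l r) mono (ml , mr , lo , hi) =
  MinMaxCond-relabel f l (λ x≤y → mono x≤y ∘ ++⁺ʳ (labels r)) ml ,
  MinMaxCond-relabel f r (λ x≤y → mono x≤y ∘ ++⁺ˡ (labels l)) mr ,
  subst₂ (λ m → All (m ≤_)) (sym (leftmost-relabel f l)) (sym (labels-relabel f t))
    (Allₚ.map⁺ (All.tabulate lo′)) ,
  subst₂ (λ m → All (_≤ m)) (sym (rightmost-relabel f r)) (sym (labels-relabel f t))
    (Allₚ.map⁺ (All.tabulate hi′))
  where
  lo′ : ∀ {y} → y ∈ labels t → f (leftmost t) ≤ f y
  lo′ y∈ with leftmost-first t y∈
  ... | inj₁ refl = ≤-refl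
  ... | inj₂ lm-y = mono (All.lookup lo y∈) lm-y
  hi′ : ∀ {y} → y ∈ labels t → f y ≤ f (rightmost t)
  hi′ y∈ with rightmost-last t y∈
  ... | inj₁ refl = ≤-refl
  ... | inj₂ y-rm = mono (All.lookup hi y∈) y-rm

MinMaxCond-transpose : ∀ k t → ¬ (k ∷ suc k ∷ []) ⊆ labels t → MinMaxCond t → MinMaxCond (relabel (transpose k) t)
MinMaxCond-transpose k t ¬k-sk = MinMaxCond-relabel (transpose k) t
  λ x≤y x-y → transpose-mono-≤ k x≤y λ { (refl , refl) → ¬k-sk x-y }

¬precedes : ∀ {a b : ℕ} α {β} → a ∉ α → b ∉ β → ¬ (a ∷ b ∷ []) ⊆ α ++ b ∷ β
¬precedes []      _  b∉ (_ ∷ʳ a-b)  = b∉ (to∈ (∷ˡ⁻ a-b))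
¬precedes []      _  b∉ (refl ∷ b⊆) = b∉ (to∈ b⊆)
¬precedes (x ∷ α) a∉ b∉ (_ ∷ʳ a-b)  = ¬precedes α (a∉ ∘ there) b∉ a-b
¬precedes (x ∷ α) a∉ b∉ (refl ∷ _)  = a∉ (here refl)

data AdmissibleTransposition (T : Tree) : LTree → LTree → Set where
  transposition : ∀ {ℓ} k → 1 ≤ k → suc k ≤ leaves T ∸ 1 →
                  AdmissibleLabeling T ℓ → AdmissibleLabeling T (relabel (transpose k) ℓ) →
                  AdmissibleTransposition T ℓ (relabel (transpose k) ℓ)

E-AdmissibleTranspositions : ∀ {T ℓ ℓ′} d → Star (AdmissibleTransposition T) ℓ ℓ′ →
                             E (leaves T) ℓ d ≡ E (leaves T) ℓ′ d
E-AdmissibleTranspositions d ε = refl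
E-AdmissibleTranspositions {T} d (transposition {ℓ} k 1≤k sk≤n-1 (_ , _ , u , mm) (_ , _ , _ , mm′) ◅ steps) =
  trans (E-transpose (leaves T) d k ℓ 1≤k sk≤n-1 u mm mm′) (E-AdmissibleTranspositions d steps)

length-labels : ∀ t → length (labels t) ≡ leaves (shape t)
length-labels (lleaf _)   = refl
length-labels (lnode l r) = trans (length-++ (labels l)) (cong₂ _+_ (length-labels l) (length-labels r))

MinMaxCond-≤-rightmost : ∀ t → MinMaxCond t → All (_≤ rightmost t) (labels t)
MinMaxCond-≤-rightmost (lleaf x)   _                = ≤-refl ∷ []
MinMaxCond-≤-rightmost (lnode l r) (_ , _ , _ , hi) = hi

Unique-bounded-∈ : ∀ {n xs} → Unique xs → length xs ≡ n → All (λ x → 1 ≤ x × x ≤ n) xs →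
                   ∀ {v} → 1 ≤ v → v ≤ n → v ∈ xs
Unique-bounded-∈ {n} {xs} u len bounded {v} 1≤v v≤n with v ∈? xs
... | yes v∈ = v∈
... | no v∉  = ⊥-elim (1+n≰n (subst₂ _≤_ (cong suc len) (length-range n)
                 (length-≤-Unique (All.tabulate (λ x∈ v≡x → v∉ (subst (_∈ xs) (sym v≡x) x∈)) ∷ u) ⊆range)))
  where
  ⊆range : ∀ {x} → x ∈ v ∷ xs → x ∈ range n
  ⊆range (here refl) = ∈-range⁺ 1≤v v≤n
  ⊆range (there x∈)  = ∈-range⁺ (proj₁ (All.lookup bounded x∈)) (proj₂ (All.lookup bounded x∈))

module Sorting (T : Tree) where

  Admissible : LTree → Set
  Admissible = AdmissibleLabeling T

  _⇝_ : LTree → LTree → Set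
  _⇝_ = Star (AdmissibleTransposition T)

  length-Admissible : ∀ {ℓ} → Admissible ℓ → length (labels ℓ) ≡ leaves T
  length-Admissible {ℓ} (shape≡ , _) = trans (length-labels ℓ) (cong leaves shape≡)

  Admissible-∈ : ∀ {ℓ v} → Admissible ℓ → 1 ≤ v → v ≤ leaves T → v ∈ labels ℓ
  Admissible-∈ adm@(_ , bounded , u , _) = Unique-bounded-∈ u (length-Admissible adm) bounded

  Admissible-bounded : ∀ {ℓ v} → Admissible ℓ → v ∈ labels ℓ → 1 ≤ v × v ≤ leaves T
  Admissible-bounded (_ , bounded , _) v∈ = All.lookup bounded v∈

  transpose-admissible : ∀ {ℓ k} → Admissible ℓ → 1 ≤ k → suc k ∈ labels ℓ → ¬ (k ∷ suc k ∷ []) ⊆ labels ℓ →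
                         AdmissibleTransposition T ℓ (relabel (transpose k) ℓ)
  transpose-admissible {ℓ} {k} adm@(shape≡ , bounded , u , mm) 1≤k sk∈ ¬k-sk =
    transposition k 1≤k (∸-monoˡ-≤ 1 (≤∧≢⇒< sk≤n sk≢n)) adm
      ( trans (shape-relabel _ ℓ) shape≡
      , subst (All _) (sym (labels-relabel _ ℓ)) (Allₚ.map⁺ (All.map (transpose-bounded 1≤k sk≤n) bounded))
      , Unique-relabel (transpose-injective k) ℓ u
      , MinMaxCond-transpose k ℓ ¬k-sk mm )
    where
    sk≤n : suc k ≤ leaves T
    sk≤n = proj₂ (Admissible-bounded adm sk∈)
    -- the maximal label leaves T is the rightmost one, so k would precede it
    sk≢n : suc k ≢ leaves T
    sk≢n sk≡n with rightmost-last ℓ (Admissible-∈ adm 1≤k (≤-trans (n≤1+n k) sk≤n))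
    ... | inj₁ k≡rm = 1+n≰n (subst (suc k ≤_) (sym k≡rm) (All.lookup (MinMaxCond-≤-rightmost ℓ mm) sk∈))
    ... | inj₂ k-rm = ¬k-sk (subst (λ m → (k ∷ m ∷ []) ⊆ labels ℓ) rm≡sk k-rm)
      where
      rm≡sk : rightmost ℓ ≡ suc k
      rm≡sk = ≤-antisym (subst (rightmost ℓ ≤_) (sym sk≡n) (proj₂ (Admissible-bounded adm (rightmost-∈ ℓ))))
                        (All.lookup (MinMaxCond-≤-rightmost ℓ mm) sk∈)

  target-Admissible : ∀ {ℓ ℓ′} → AdmissibleTransposition T ℓ ℓ′ → Admissible ℓ′
  target-Admissible (transposition _ _ _ _ adm′) = adm′

  move-down : ∀ m s {ℓ zs} → Admissible ℓ → labels ℓ ≡ range m ++ suc (s + m) ∷ zs →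
              ∃₂ λ ℓ′ zs′ → ℓ ⇝ ℓ′ × Admissible ℓ′ × labels ℓ′ ≡ range (suc m) ++ zs′
  move-down m zero {ℓ} {zs} adm labels≡ = ℓ , zs , ε , adm , trans labels≡ (range-suc m zs)
  move-down m (suc s) {ℓ} {zs} adm@(_ , _ , u , _) labels≡ =
    let ℓ′ , zs′ , steps , adm′ , labels′≡ = move-down m s (target-Admissible step) labels₁≡
    in  ℓ′ , zs′ , step ◅ steps , adm′ , labels′≡
    where
    k : ℕ
    k = suc (s + m)
    m<k : m < k
    m<k = s≤s (m≤n+m m s)
    sk∉zs : suc k ∉ zs
    sk∉zs with Unique-++⁻ (range m) (subst Unique labels≡ u)
    ... | _ , (sk∉ ∷ _) , _ = All¬⇒¬Any sk∉
    ¬k-sk : ¬ (k ∷ suc k ∷ []) ⊆ labels ℓ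
    ¬k-sk = subst (λ xs → ¬ (k ∷ suc k ∷ []) ⊆ xs) (sym labels≡) (¬precedes (range m) (range-∉ m<k) sk∉zs)
    step : AdmissibleTransposition T ℓ (relabel (transpose k) ℓ)
    step = transpose-admissible adm (s≤s z≤n) (subst (suc k ∈_) (sym labels≡) (∈-++⁺ʳ (range m) (here refl))) ¬k-sk
    labels₁≡ : labels (relabel (transpose k) ℓ) ≡ range m ++ k ∷ map (transpose k) zs
    labels₁≡ = begin
      labels (relabel (transpose k) ℓ)                                  ≡⟨ labels-relabel _ ℓ ⟩
      map (transpose k) (labels ℓ)                                      ≡⟨ cong (map (transpose k)) labels≡ ⟩
      map (transpose k) (range m ++ suc k ∷ zs)                         ≡⟨ map-++ (transpose k) (range m) _ ⟩
      map (transpose k) (range m) ++ transpose k (suc k) ∷ map (transpose k) zs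
        ≡⟨ cong₂ (λ xs y → xs ++ y ∷ map (transpose k) zs)
                 (map-transpose-∉ up (range-∉ m<k) (range-∉ (≤-trans m<k (n≤1+n k)))) (transpose-suc k) ⟩
      range m ++ k ∷ map (transpose k) zs                               ∎
      where open ≡-Reasoning

  length-prefix : ∀ {ℓ} m {ys} → Admissible ℓ → labels ℓ ≡ range m ++ ys → m + length ys ≡ leaves T
  length-prefix {ℓ} m {ys} adm labels≡ = begin
    m + length ys                 ≡⟨ cong (_+ length ys) (length-range m) ⟨
    length (range m) + length ys  ≡⟨ length-++ (range m) ⟨
    length (range m ++ ys)        ≡⟨ cong length labels≡ ⟨
    length (labels ℓ)             ≡⟨ length-Admissible adm ⟩
    leaves T                      ∎
    where open ≡-Reasoning

  next-label : ∀ {ℓ m j zs} → Admissible ℓ → labels ℓ ≡ range m ++ j ∷ zs → ∃ λ s → j ≡ suc (s + m)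
  next-label {ℓ} {m} {j} adm@(_ , _ , u , _) labels≡ =
    j ∸ suc m , trans (sym (m∸n+n≡m m<j)) (+-suc (j ∸ suc m) m)
    where
    j∈ : j ∈ labels ℓ
    j∈ = subst (j ∈_) (sym labels≡) (∈-++⁺ʳ (range m) (here refl))
    j∉range : j ∉ range m
    j∉range j∈range = proj₂ (proj₂ (Unique-++⁻ (range m) (subst Unique labels≡ u))) j∈range (here refl)
    m<j : m < j
    m<j = ≰⇒> λ j≤m → j∉range (∈-range⁺ (proj₁ (Admissible-bounded adm j∈)) j≤m)

  sort : ∀ i m {ℓ ys} → i + m ≡ leaves T → Admissible ℓ → labels ℓ ≡ range m ++ ys →
         ∃ λ ℓ₀ → ℓ ⇝ ℓ₀ × Admissible ℓ₀ × labels ℓ₀ ≡ range (leaves T)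
  sort zero    m {ys = []}    refl adm labels≡ = _ , ε , adm , trans labels≡ (++-identityʳ (range m))
  sort zero    m {ys = _ ∷ _} refl adm labels≡ = ⊥-elim (m+1+n≢m m (length-prefix m adm labels≡))
  sort (suc i) m {ys = []}    i+m≡n adm labels≡ =
    ⊥-elim (m≢1+n+m m (trans (sym (+-identityʳ m)) (trans (length-prefix m adm labels≡) (sym i+m≡n))))
  sort (suc i) m {ys = _ ∷ _} i+m≡n adm labels≡ with next-label adm labels≡
  ... | s , refl with move-down m s adm labels≡
  ... | _ , _ , steps₁ , adm₁ , labels₁≡ with sort i (suc m) (trans (+-suc i m) i+m≡n) adm₁ labels₁≡
  ... | ℓ₀ , steps₀ , adm₀ , sorted₀ = ℓ₀ , steps₁ ◅◅ steps₀ , adm₀ , sorted₀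

  sorted : ∀ {ℓ} → Admissible ℓ → ∃ λ ℓ₀ → ℓ ⇝ ℓ₀ × Admissible ℓ₀ × labels ℓ₀ ≡ range (leaves T)
  sorted adm = sort (leaves T) 0 (+-identityʳ (leaves T)) adm refl

++-injective : ∀ {A : Set} (xs ys : List A) {zs ws} → length xs ≡ length ys → xs ++ zs ≡ ys ++ ws → xs ≡ ys × zs ≡ ws
++-injective []       []       _   eq = refl , eq
++-injective (x ∷ xs) (y ∷ ys) len eq with ∷-injective eq
... | refl , eq′ with ++-injective xs ys (suc-injective len) eq′
...   | refl , zs≡ws = refl , zs≡ws

node-injective : ∀ {a b c d} → node a b ≡ node c d → a ≡ c × b ≡ d
node-injective refl = refl , refl

labels-injective : ∀ t t′ → shape t ≡ shape t′ → labels t ≡ labels t′ → t ≡ t′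
labels-injective (lleaf x)   (lleaf y)     _      refl    = refl
labels-injective (lnode l r) (lnode l′ r′) shape≡ labels≡
  with node-injective shape≡
... | shape-l≡ , shape-r≡
  with ++-injective (labels l) (labels l′)
         (trans (length-labels l) (trans (cong leaves shape-l≡) (sym (length-labels l′)))) labels≡
... | labels-l≡ , labels-r≡ =
  cong₂ lnode (labels-injective l l′ shape-l≡ labels-l≡) (labels-injective r r′ shape-r≡ labels-r≡)

proposition4p8 : (T : Tree) (n d : ℕ) → leaves T ≡ n → 2 ≤ n → d ≤ n ∸ 2 →
                 (ℓ ℓ′ : LTree) → AdmissibleLabeling T ℓ → AdmissibleLabeling T ℓ′ →
                   E n ℓ d ≡ E n ℓ′ d
proposition4p8 T _ d refl _ _ ℓ ℓ′ adm adm′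
  with ℓ₀  , steps  , (shape₀  , _) , sorted₀  ← Sorting.sorted T adm
     | ℓ₀′ , steps′ , (shape₀′ , _) , sorted₀′ ← Sorting.sorted T adm′ = begin
  E (leaves T) ℓ d    ≡⟨ E-AdmissibleTranspositions d steps ⟩
  E (leaves T) ℓ₀ d   ≡⟨ cong (λ t → E (leaves T) t d) ℓ₀≡ℓ₀′ ⟩
  E (leaves T) ℓ₀′ d  ≡⟨ E-AdmissibleTranspositions d steps′ ⟨
  E (leaves T) ℓ′ d   ∎
  where
  open ≡-Reasoning
  ℓ₀≡ℓ₀′ : ℓ₀ ≡ ℓ₀′
  ℓ₀≡ℓ₀′ = labels-injective ℓ₀ ℓ₀′ (trans shape₀ (sym shape₀′)) (trans sorted₀ (sym sorted₀′))
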